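{- Let $\mathbf{P}=(P,\leq_P)$ be a finite partial order. Then every two parallel fans in $\mathbf{P}$ are skewly topped if and only if every two parallel bouquets in $\mathbf{P}$ are skewly topped.
   Context: A bouquet in $\mathbf{P}$ is a subset $B\subseteq P$ with at least two elements such that $\max B$ exists under $\leq_P$. A fan is a bouquet $F$ such that no two distinct elements of $F-\{\max F\}$ are $\leq_P$-comparable. Two bouquets (or fans) $B_0,B_1$ are parallel if no element of $B_0$ is $\leq_P$-comparable with any element of $B_1$. Two parallel bouquets (or fans) $B_0,B_1$ are skewly topped if there exist $m\in P$ and $i\in\{0,1\}$ such that $m\geq_P\max B_i$, $m\not\geq_P\max B_{1-i}$, and $m\geq_P p$ for all $p\in B_{1-i}-\{\max B_{1-i}\}$. -}

module Defs where

open import Data.Nat using (ℕ; _≤_)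
open import Data.Fin using (Fin)
open import Data.Fin.Subset using (Subset; _∈_; ∣_∣; _∉_)
open import Data.Product using (Σ; ∃; _×_; _,_)
open import Data.Sum using (_⊎_)
open import Relation.Nullary using (¬_)
open import Relation.Binary.PropositionalEquality using (_≡_; _≢_)
open import Relation.Binary.Definitions using ()
open import Relation.Binary.Structures using (IsPartialOrder)
open import Level using (Level)

-- A finite partial order: carrier Fin n (any finite set up to bijection),
-- order relation _≤P_ with propositional equality as the underlying equality.

module _ {ℓ : Level} {n : ℕ} (_≤P_ : Fin n → Fin n → Set ℓ) where

  IsMax : Subset n → Fin n → Set ℓ
  IsMax B m = m ∈ B × (∀ x → x ∈ B → x ≤P m)

  Comparable : Fin n → Fin n → Set ℓ
  Comparable x y = x ≤P y ⊎ y ≤P x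

  IsBouquet : Subset n → Set ℓ
  IsBouquet B = (2 ≤ ∣ B ∣) × ∃ (IsMax B)

  IsFan : Subset n → Set ℓ
  IsFan B = IsBouquet B ×
    (∀ m → IsMax B m → ∀ x y → x ∈ B → y ∈ B → x ≢ m → y ≢ m → x ≢ y →
       ¬ Comparable x y)

  Parallel : Subset n → Subset n → Set ℓ
  Parallel B₀ B₁ = ∀ x y → x ∈ B₀ → y ∈ B₁ → ¬ Comparable x y

  SkewTop : Subset n → Subset n → Set ℓ
  SkewTop Bᵢ Bⱼ = ∃ λ mᵢ → IsMax Bᵢ mᵢ × ∃ λ mⱼ → IsMax Bⱼ mⱼ ×
    ∃ λ m → (mᵢ ≤P m) × ¬ (mⱼ ≤P m) ×
      (∀ p → p ∈ Bⱼ → p ≢ mⱼ → p ≤P m)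

  SkewlyTopped : Subset n → Subset n → Set ℓ
  SkewlyTopped B₀ B₁ = SkewTop B₀ B₁ ⊎ SkewTop B₁ B₀

-- Shrinking a bouquet to a fan loses nothing.  Given a bouquet B with top m,
-- let F consist of m together with the maximal elements of B − {m}.  By
-- finiteness every element of B − {m} lies below one of them, so F is a fan
-- inside B (two distinct maximal elements are incomparable).  Parallelism
-- passes to subsets, and a witness topping F₀ skewly over F₁ also tops B₀
-- skewly over B₁, since everything in B₁ − {m₁} is below some element of
-- F₁ − {m₁}.  Conversely every fan is a bouquet.
module Submission where

open import Defs
open import Data.Nat using (ℕ; _≤_)
open import Data.Nat.Properties using (<⇒≱; ≤-trans; ≤-reflexive; module ≤-Reasoning)
open import Data.Fin using (Fin; _≟_)
open import Data.Fin.Properties using (any?; all?)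
open import Data.Fin.Subset using (Subset; _⊆_; _-_; ⁅_⁆; ∣_∣) renaming (_∈_ to _∈ₛ_)
open import Data.Fin.Subset.Properties
  using (_∈?_; x∈p∧x≢y⇒x∈p-y; x∈p⇒∣p-x∣<∣p∣; p⊆q⇒∣p∣≤∣q∣; ∣⁅x⁆∣≡1; x∈⁅y⁆⇒x≡y; x∈⁅x⁆)
open import Data.Fin.Induction using (po-noetherian)
open import Data.Vec using (tabulate)
open import Data.Vec.Properties using (lookup∘tabulate; lookup⇒[]=; []=⇒lookup)
open import Data.Product using (_×_; _,_; ∃; proj₁; proj₂)
open import Data.Sum using (_⊎_; inj₁; inj₂)
open import Data.Empty using (⊥-elim)
open import Function using (flip)
open import Level using (Level; _⊔_; 0ℓ)
open import Relation.Nullary using (¬_; yes; no; does)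
open import Relation.Nullary.Decidable using (_×-dec_; _⊎-dec_; _→-dec_; ¬?; dec-true; decidable-stable)
open import Relation.Binary.PropositionalEquality using (_≡_; _≢_; refl; sym; trans)
open import Relation.Binary.Structures using (IsPartialOrder)
open import Relation.Binary.Definitions using (Decidable)
import Relation.Binary.Construct.NonStrictToStrict as ToStrict
open import Relation.Unary using (Pred)
import Relation.Unary as U
open import Induction.WellFounded using (Acc; acc)

private
  variable
    a ℓ : Level
    n : ℕ

module _ {P : Pred (Fin n) a} (P? : U.Decidable P) where

  filter : Subset n
  filter = tabulate (λ x → does (P? x))

  ∈-filter⁺ : ∀ {x} → P x → x ∈ₛ filter
  ∈-filter⁺ {x} px = lookup⇒[]= x filter (trans (lookup∘tabulate _ x) (dec-true (P? x) px))

  ∈-filter⁻ : ∀ {x} → x ∈ₛ filter → P x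
  ∈-filter⁻ {x} x∈ with P? x | trans (sym (lookup∘tabulate _ x)) ([]=⇒lookup x∈)
  ... | yes px | _ = px
  ... | no _   | ()

x∈p∧y∈p∧x≢y⇒2≤∣p∣ : {p : Subset n} {x y : Fin n} → x ∈ₛ p → y ∈ₛ p → x ≢ y → 2 ≤ ∣ p ∣
x∈p∧y∈p∧x≢y⇒2≤∣p∣ {p = p} {x} {y} x∈p y∈p x≢y = begin-strict
  1             ≡⟨ sym (∣⁅x⁆∣≡1 y) ⟩
  ∣ ⁅ y ⁆ ∣     ≤⟨ p⊆q⇒∣p∣≤∣q∣ ⁅y⁆⊆p-x ⟩
  ∣ p - x ∣     <⟨ x∈p⇒∣p-x∣<∣p∣ x∈p ⟩
  ∣ p ∣         ∎
  where
  open ≤-Reasoning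
  ⁅y⁆⊆p-x : ⁅ y ⁆ ⊆ p - x
  ⁅y⁆⊆p-x z∈ with refl ← x∈⁅y⁆⇒x≡y y z∈ = x∈p∧x≢y⇒x∈p-y y∈p (λ y≡x → x≢y (sym y≡x))

2≤∣p∣⇒∃≢ : {p : Subset n} → 2 ≤ ∣ p ∣ → ∀ x → ∃ λ y → y ∈ₛ p × y ≢ x
2≤∣p∣⇒∃≢ {p = p} 2≤∣p∣ x with any? (λ y → (y ∈? p) ×-dec ¬? (y ≟ x))
... | yes found = found
... | no ∄ = ⊥-elim (<⇒≱ 2≤∣p∣ (≤-trans (p⊆q⇒∣p∣≤∣q∣ p⊆⁅x⁆) (≤-reflexive (∣⁅x⁆∣≡1 x))))
  where
  p⊆⁅x⁆ : p ⊆ ⁅ x ⁆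
  p⊆⁅x⁆ {y} y∈p with y ≟ x
  ... | yes refl = x∈⁅x⁆ x
  ... | no y≢x   = ⊥-elim (∄ (y , y∈p , y≢x))

module _ (_≤P_ : Fin n → Fin n → Set ℓ) where

  ParallelFansSkewlyTopped : Set ℓ
  ParallelFansSkewlyTopped = ∀ (F₀ F₁ : Subset n) → IsFan _≤P_ F₀ → IsFan _≤P_ F₁ →
    Parallel _≤P_ F₀ F₁ → SkewlyTopped _≤P_ F₀ F₁

  ParallelBouquetsSkewlyTopped : Set ℓ
  ParallelBouquetsSkewlyTopped = ∀ (B₀ B₁ : Subset n) → IsBouquet _≤P_ B₀ → IsBouquet _≤P_ B₁ →
    Parallel _≤P_ B₀ B₁ → SkewlyTopped _≤P_ B₀ B₁

  Parallel-antitone : {B₀ B₁ C₀ C₁ : Subset n} →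
    C₀ ⊆ B₀ → C₁ ⊆ B₁ → Parallel _≤P_ B₀ B₁ → Parallel _≤P_ C₀ C₁
  Parallel-antitone C₀⊆B₀ C₁⊆B₁ par x y x∈C₀ y∈C₁ = par x y (C₀⊆B₀ x∈C₀) (C₁⊆B₁ y∈C₁)

  bouquets⇒fans : ParallelBouquetsSkewlyTopped → ParallelFansSkewlyTopped
  bouquets⇒fans bouquets F₀ F₁ F₀-fan F₁-fan = bouquets F₀ F₁ (proj₁ F₀-fan) (proj₁ F₁-fan)

module _ {_≤P_ : Fin n → Fin n → Set ℓ}
         (isPO : IsPartialOrder _≡_ _≤P_) (_≤?_ : Decidable _≤P_) where

  open IsPartialOrder isPO using (antisym) renaming (refl to ≤-refl; trans to ≤P-trans)
  open ToStrict _≡_ _≤P_ using (_<_; <-decidable)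

  IsMax-unique : ∀ {B x y} → IsMax _≤P_ B x → IsMax _≤P_ B y → x ≡ y
  IsMax-unique (x∈B , ≤x) (y∈B , ≤y) = antisym (≤y _ x∈B) (≤x _ y∈B)

  Maximal : Pred (Fin n) a → Pred (Fin n) (a ⊔ ℓ)
  Maximal S x = S x × (∀ y → S y → x ≤P y → x ≡ y)

  maximal? : {S : Pred (Fin n) a} → U.Decidable S → U.Decidable (Maximal S)
  maximal? S? x = S? x ×-dec all? (λ y → S? y →-dec (x ≤? y →-dec x ≟ y))

  ≤-maximal : {S : Pred (Fin n) a} → U.Decidable S → ∀ {x} → S x → ∃ λ y → Maximal S y × x ≤P y
  ≤-maximal {S = S} S? {x} = climb (po-noetherian isPO x)
    where
    climb : ∀ {x} → Acc (flip _<_) x → S x → ∃ λ y → Maximal S y × x ≤P y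
    climb {x} (acc above) sx with any? (λ y → S? y ×-dec <-decidable _≟_ _≤?_ x y)
    ... | yes (y , sy , x<y) with z , maximal-z , y≤z ← climb (above x<y) sy =
      z , maximal-z , ≤P-trans (proj₁ x<y) y≤z
    ... | no ∄ = x , (sx , λ y sy x≤y → decidable-stable (x ≟ y) (λ x≢y → ∄ (y , sy , x≤y , x≢y))) , ≤-refl

  Lower : Subset n → Fin n → Pred (Fin n) 0ℓ
  Lower B m x = x ∈ₛ B × x ≢ m

  lower? : ∀ B m → U.Decidable (Lower B m)
  lower? B m x = (x ∈? B) ×-dec ¬? (x ≟ m)

  InFanOf : Subset n → Fin n → Pred (Fin n) ℓ
  InFanOf B m x = x ≡ m ⊎ Maximal (Lower B m) x

  inFanOf? : ∀ B m → U.Decidable (InFanOf B m)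
  inFanOf? B m x = (x ≟ m) ⊎-dec maximal? (lower? B m) x

  fanOf : Subset n → Fin n → Subset n
  fanOf B m = filter (inFanOf? B m)

  module _ {B : Subset n} {m : Fin n} (m-max : IsMax _≤P_ B m) where

    fanOf⊆ : fanOf B m ⊆ B
    fanOf⊆ x∈ with ∈-filter⁻ (inFanOf? B m) x∈
    ... | inj₁ refl              = proj₁ m-max
    ... | inj₂ ((x∈B , _) , _)   = x∈B

    fanOf-max : IsMax _≤P_ (fanOf B m) m
    fanOf-max = ∈-filter⁺ (inFanOf? B m) (inj₁ refl) , λ x x∈ → proj₂ m-max x (fanOf⊆ x∈)

    fanOf-lower : ∀ {x} → x ∈ₛ fanOf B m → x ≢ m → Maximal (Lower B m) x
    fanOf-lower x∈ x≢m with ∈-filter⁻ (inFanOf? B m) x∈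
    ... | inj₁ x≡m     = ⊥-elim (x≢m x≡m)
    ... | inj₂ maximal = maximal

    lower-≤-fanOf : ∀ {x} → Lower B m x → ∃ λ y → Lower (fanOf B m) m y × x ≤P y
    lower-≤-fanOf lx with y , maximal-y , x≤y ← ≤-maximal (lower? B m) lx =
      y , (∈-filter⁺ (inFanOf? B m) (inj₂ maximal-y) , proj₂ (proj₁ maximal-y)) , x≤y

    fanOf-isFan : 2 ≤ ∣ B ∣ → IsFan _≤P_ (fanOf B m)
    fanOf-isFan 2≤∣B∣ = (two , m , fanOf-max) , antichain
      where
      two : 2 ≤ ∣ fanOf B m ∣
      two = let x , x∈B , x≢m       = 2≤∣p∣⇒∃≢ 2≤∣B∣ m
                y , (y∈F , y≢m) , _ = lower-≤-fanOf (x∈B , x≢m)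
            in x∈p∧y∈p∧x≢y⇒2≤∣p∣ y∈F (proj₁ fanOf-max) y≢m

      antichain : ∀ m′ → IsMax _≤P_ (fanOf B m) m′ → ∀ x y → x ∈ₛ fanOf B m → y ∈ₛ fanOf B m →
                  x ≢ m′ → y ≢ m′ → x ≢ y → ¬ Comparable _≤P_ x y
      antichain m′ m′-max x y x∈ y∈ x≢m′ y≢m′ x≢y x~y
        with refl ← IsMax-unique m′-max fanOf-max | x~y
      ... | inj₁ x≤y = x≢y (proj₂ (fanOf-lower x∈ x≢m′) y (proj₁ (fanOf-lower y∈ y≢m′)) x≤y)
      ... | inj₂ y≤x = x≢y (sym (proj₂ (fanOf-lower y∈ y≢m′) x (proj₁ (fanOf-lower x∈ x≢m′)) y≤x))

  SkewTop-fanOf⇒SkewTop : ∀ {Bᵢ mᵢ Bⱼ mⱼ} → IsMax _≤P_ Bᵢ mᵢ → IsMax _≤P_ Bⱼ mⱼ →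
    SkewTop _≤P_ (fanOf Bᵢ mᵢ) (fanOf Bⱼ mⱼ) → SkewTop _≤P_ Bᵢ Bⱼ
  SkewTop-fanOf⇒SkewTop {Bᵢ} {mᵢ} {Bⱼ} {mⱼ} mᵢ-max mⱼ-max
    (_ , mᵢ′-max , _ , mⱼ′-max , t , mᵢ′≤t , mⱼ′≰t , lowerⱼ≤t)
    with refl ← IsMax-unique mᵢ′-max (fanOf-max mᵢ-max)
       | refl ← IsMax-unique mⱼ′-max (fanOf-max mⱼ-max) =
    mᵢ , mᵢ-max , mⱼ , mⱼ-max , t , mᵢ′≤t , mⱼ′≰t , below-t
    where
    below-t : ∀ x → x ∈ₛ Bⱼ → x ≢ mⱼ → x ≤P t
    below-t x x∈ x≢mⱼ with y , (y∈F , y≢mⱼ) , x≤y ← lower-≤-fanOf mⱼ-max (x∈ , x≢mⱼ) =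
      ≤P-trans x≤y (lowerⱼ≤t y y∈F y≢mⱼ)

  SkewlyTopped-fanOf⇒SkewlyTopped : ∀ {B₀ m₀ B₁ m₁} → IsMax _≤P_ B₀ m₀ → IsMax _≤P_ B₁ m₁ →
    SkewlyTopped _≤P_ (fanOf B₀ m₀) (fanOf B₁ m₁) → SkewlyTopped _≤P_ B₀ B₁
  SkewlyTopped-fanOf⇒SkewlyTopped m₀-max m₁-max (inj₁ s) = inj₁ (SkewTop-fanOf⇒SkewTop m₀-max m₁-max s)
  SkewlyTopped-fanOf⇒SkewlyTopped m₀-max m₁-max (inj₂ s) = inj₂ (SkewTop-fanOf⇒SkewTop m₁-max m₀-max s)

  fans⇒bouquets : ParallelFansSkewlyTopped _≤P_ → ParallelBouquetsSkewlyTopped _≤P_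
  fans⇒bouquets fans B₀ B₁ (2≤∣B₀∣ , m₀ , m₀-max) (2≤∣B₁∣ , m₁ , m₁-max) par =
    SkewlyTopped-fanOf⇒SkewlyTopped m₀-max m₁-max
      (fans (fanOf B₀ m₀) (fanOf B₁ m₁) (fanOf-isFan m₀-max 2≤∣B₀∣) (fanOf-isFan m₁-max 2≤∣B₁∣)
        (Parallel-antitone _≤P_ (fanOf⊆ m₀-max) (fanOf⊆ m₁-max) par))

proposition2p4 : {ℓ : Level} (n : ℕ) (_≤P_ : Fin n → Fin n → Set ℓ) →
    IsPartialOrder _≡_ _≤P_ → Decidable _≤P_ →
    ((∀ (F₀ F₁ : Subset n) → IsFan _≤P_ F₀ → IsFan _≤P_ F₁ →
    Parallel _≤P_ F₀ F₁ → SkewlyTopped _≤P_ F₀ F₁) →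
    (∀ (B₀ B₁ : Subset n) → IsBouquet _≤P_ B₀ → IsBouquet _≤P_ B₁ →
    Parallel _≤P_ B₀ B₁ → SkewlyTopped _≤P_ B₀ B₁))
    × ((∀ (B₀ B₁ : Subset n) → IsBouquet _≤P_ B₀ → IsBouquet _≤P_ B₁ →
    Parallel _≤P_ B₀ B₁ → SkewlyTopped _≤P_ B₀ B₁) →
    (∀ (F₀ F₁ : Subset n) → IsFan _≤P_ F₀ → IsFan _≤P_ F₁ →
    Parallel _≤P_ F₀ F₁ → SkewlyTopped _≤P_ F₀ F₁))
proposition2p4 n _≤P_ isPO _≤?_ = fans⇒bouquets isPO _≤?_ , bouquets⇒fans _≤P_
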